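{- For all integers $N,n,i\ge0$, \[ \sum_{k=i}^{\lfloor (N-n)/2\rfloor}y^{k-i}\binom{N}{n+2k}(1+y)^{N-n-2k}\left(\binom{n+2k}{k-i}-\binom{n+2k}{k-i-1}\right)=\sum_{j=0}^{N-n-2i}y^j\left(\binom{N}{j}\binom{N}{n+2i+j}-\binom{N}{j-1}\binom{N}{n+2i+j+1}\right). \]
   Context: $y$ is an indeterminate; binomial coefficients with negative lower index (or lower index larger than the upper one) are $0$; empty sums are $0$. -}

module Defs where

open import Level using (Level)
open import Data.Nat as ℕ using (ℕ; zero; suc; _∸_; _≤ᵇ_)
open import Data.Nat.Combinatorics using (_C_)
open import Data.Integer as ℤ using (ℤ; +_; -[1+_])
open import Data.Bool using (if_then_else_)
open import Algebra.Bundles using (CommutativeRing; Semiring)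
import Algebra.Definitions.RawSemiring as RS

⌊_/2⌋ : ℤ → ℤ
⌊ + m /2⌋ = + (m ℕ./ 2)
⌊ -[1+ m ] /2⌋ = -[1+ m ℕ./ 2 ]

-- binomial coefficient with integer lower index: 0 if negative (and 0 if > upper, by _C_)
binomℤ : ℕ → ℤ → ℕ
binomℤ n (+ k) = n C k
binomℤ n -[1+ _ ] = 0

module _ {c ℓ : Level} (R : CommutativeRing c ℓ) where
  open CommutativeRing R
  open RS (Semiring.rawSemiring semiring) using (_×_; _^_)

  ι : ℕ → Carrier
  ι n = n × 1#

  sumLen : ℕ → ℕ → (ℕ → Carrier) → Carrier
  sumLen a zero f = 0#
  sumLen a (suc len) f = f a + sumLen (suc a) len f

  sumFromTo : ℕ → ℤ → (ℕ → Carrier) → Carrier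
  sumFromTo a (+ b) f = if a ≤ᵇ b then sumLen a (suc (b ∸ a)) f else 0#
  sumFromTo a -[1+ _ ] f = 0#

  pow : Carrier → ℕ → Carrier
  pow = _^_

-- Both sides are built from the coefficients c_m of x^m in (x + 1 + y + y x⁻¹)^N = ((1 + x)(1 + y x⁻¹))^N.
-- The product form gives c_m = Σ_j y^j C(N,j) C(N,m+j); expanding ((1 + y) + (x + y x⁻¹))^N instead gives
-- c_m = Σ_t y^t C(N,m+2t) C(m+2t,t) (1+y)^(N-m-2t). Both families satisfy the recursion in N coming from one
-- more factor x + 1 + y + y x⁻¹ and agree at N = 0, so they coincide. With m = n + 2i, splitting the
-- differences C(k,t) - C(k,t-1) on the left and C(N,j)C(N,m+j) - C(N,j-1)C(N,m+j+1) on the right turns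
-- each side into c_m - y c_{m+2}, computed in the trinomial and in the product form respectively.

module Submission where

open import Defs
open import Level using (Level)
open import Data.Bool using (true; false; T)
open import Data.Empty using (⊥-elim)
open import Data.Nat as ℕ using (ℕ; zero; suc; _≤_; _<_; s≤s)
import Data.Nat.Properties as ℕP
open import Data.Nat.DivMod using (+-distrib-/-∣ˡ; m*n/n≡m; m<n*o⇒m/o<n; /-monoˡ-≤; m/n≤m)
open import Data.Nat.Divisibility using (m∣m*n)
open import Data.Nat.Combinatorics using (_C_; k>n⇒nCk≡0; nCk+nC[k+1]≡[n+1]C[k+1]; nCk≡nC[n∸k])
open import Data.Integer as ℤ using (+_; -[1+_])
import Data.Integer.Properties as ℤP
open import Relation.Nullary using (yes; no)
open import Relation.Binary.PropositionalEquality as P using (_≡_)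
open import Algebra.Bundles using (CommutativeRing; Semiring)

+m-+n≡+[m∸n] : ∀ {m n} → n ≤ m → + m ℤ.- + n ≡ + (m ℕ.∸ n)
+m-+n≡+[m∸n] {m} {n} n≤m = P.trans (ℤP.m-n≡m⊖n m n) (ℤP.⊖-≥ n≤m)

+[m+n]-+m≡+n : ∀ m n → + (m ℕ.+ n) ℤ.- + m ≡ + n
+[m+n]-+m≡+n m n = P.trans (+m-+n≡+[m∸n] (ℕP.m≤m+n m n)) (P.cong +_ (ℕP.m+n∸m≡n m n))

m<n⇒+m-+n≡-[1+n∸1+m] : ∀ {m n} → m < n → + m ℤ.- + n ≡ -[1+ n ℕ.∸ suc m ]
m<n⇒+m-+n≡-[1+n∸1+m] {m} {n} m<n =
  P.trans (ℤP.m-n≡m⊖n m n) (P.trans (ℤP.⊖-< m<n) (P.cong (λ k → ℤ.- + k) (ℕP.+-∸-assoc 1 m<n)))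

+m-+n-+o≡+m-+[n+o] : ∀ m n o → + m ℤ.- + n ℤ.- + o ≡ + m ℤ.- + (n ℕ.+ o)
+m-+n-+o≡+m-+[n+o] m n o = begin
  + m ℤ.- + n ℤ.- + o         ≡⟨ ℤP.+-assoc (+ m) (ℤ.- + n) (ℤ.- + o) ⟩
  + m ℤ.+ (ℤ.- + n ℤ.- + o)   ≡⟨ P.cong (λ k → + m ℤ.+ k) (ℤP.neg-distrib-+ (+ n) (+ o)) ⟨
  + m ℤ.- (+ n ℤ.+ + o)       ≡⟨ P.cong (λ k → + m ℤ.- k) (ℤP.pos-+ n o) ⟨
  + m ℤ.- + (n ℕ.+ o)         ∎
  where open P.≡-Reasoning

[2i+d]/2≡i+d/2 : ∀ i d → (2 ℕ.* i ℕ.+ d) ℕ./ 2 ≡ i ℕ.+ d ℕ./ 2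
[2i+d]/2≡i+d/2 i d = P.trans (+-distrib-/-∣ˡ d (m∣m*n i))
  (P.cong (ℕ._+ d ℕ./ 2) (P.trans (P.cong (ℕ._/ 2) (ℕP.*-comm 2 i)) (m*n/n≡m i 2)))

d/2<t⇒d<2t : ∀ {d t} → d ℕ./ 2 < t → d < 2 ℕ.* t
d/2<t⇒d<2t {d} {t} d/2<t with 2 ℕ.* t ℕ.≤? d
... | no 2t≰d = ℕP.≰⇒> 2t≰d
... | yes 2t≤d = ⊥-elim (ℕP.<⇒≱ d/2<t (P.subst (ℕ._≤ d ℕ./ 2) t≡2t/2 (/-monoˡ-≤ 2 2t≤d)))
  where
  t≡2t/2 : 2 ℕ.* t ℕ./ 2 ≡ t
  t≡2t/2 = P.trans (P.cong (ℕ._/ 2) (ℕP.*-comm 2 t)) (m*n/n≡m t 2)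

m+2[1+s]≡2+[m+2s] : ∀ m s → m ℕ.+ 2 ℕ.* suc s ≡ suc (suc (m ℕ.+ 2 ℕ.* s))
m+2[1+s]≡2+[m+2s] m s = P.trans (P.cong (m ℕ.+_) (ℕP.*-suc 2 s)) (P.trans (ℕP.+-suc m _) (P.cong suc (ℕP.+-suc m _)))

n+2[i+t]≡[n+2i]+2t : ∀ n i t → n ℕ.+ 2 ℕ.* (i ℕ.+ t) ≡ n ℕ.+ 2 ℕ.* i ℕ.+ 2 ℕ.* t
n+2[i+t]≡[n+2i]+2t n i t = P.trans (P.cong (n ℕ.+_) (ℕP.*-distribˡ-+ 2 i t)) (P.sym (ℕP.+-assoc n _ _))

_C⁻_ : ℕ → ℕ → ℕ
N C⁻ zero = 0
N C⁻ suc k = N C k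

[1+N]Ck≡NCk+NC⁻k : ∀ N k → suc N C k ≡ N C k ℕ.+ N C⁻ k
[1+N]Ck≡NCk+NC⁻k N zero = P.refl
[1+N]Ck≡NCk+NC⁻k N (suc k) = P.trans (P.sym (nCk+nC[k+1]≡[n+1]C[k+1] N k)) (ℕP.+-comm (N C k) _)

binomℤ[t-1]≡C⁻ : ∀ N t → binomℤ N (+ t ℤ.- ℤ.1ℤ) ≡ N C⁻ t
binomℤ[t-1]≡C⁻ N zero = P.refl
binomℤ[t-1]≡C⁻ N (suc t) = P.refl

[1+2s]Cs≡[1+2s]C[1+s] : ∀ s → suc (2 ℕ.* s) C s ≡ suc (2 ℕ.* s) C suc s
[1+2s]Cs≡[1+2s]C[1+s] s = P.trans (nCk≡nC[n∸k] s≤1+2s) (P.cong (suc (2 ℕ.* s) C_) 1+2s∸s≡1+s)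
  where
  s≤1+2s : s ≤ suc (2 ℕ.* s)
  s≤1+2s = ℕP.≤-trans (ℕP.m≤m+n s (s ℕ.+ 0)) (ℕP.n≤1+n _)
  1+2s∸s≡1+s : suc (2 ℕ.* s) ℕ.∸ s ≡ suc s
  1+2s∸s≡1+s = P.trans (P.cong (ℕ._∸ s) (P.sym (ℕP.+-suc s (s ℕ.+ 0))))
                       (P.trans (ℕP.m+n∸m≡n s _) (P.cong suc (ℕP.+-identityʳ s)))

module Sums {c ℓ : Level} (R : CommutativeRing c ℓ) where
  open CommutativeRing R hiding (zero)
  open import Algebra.Properties.AbelianGroup +-abelianGroup using (⁻¹-∙-comm) renaming (ε⁻¹≈ε to -0#≈0#)
  open import Algebra.Properties.CommutativeSemigroup +-commutativeSemigroup using () renaming (interchange to +-interchange)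

  ∑ : ℕ → ℕ → (ℕ → Carrier) → Carrier
  ∑ = sumLen R

  ∑-cong : ∀ a l {f g} → (∀ k → f k ≈ g k) → ∑ a l f ≈ ∑ a l g
  ∑-cong a zero f≈g = refl
  ∑-cong a (suc l) f≈g = +-cong (f≈g a) (∑-cong (suc a) l f≈g)

  ∑-+ : ∀ a l f g → ∑ a l (λ k → f k + g k) ≈ ∑ a l f + ∑ a l g
  ∑-+ a zero f g = sym (+-identityˡ 0#)
  ∑-+ a (suc l) f g = trans (+-congˡ (∑-+ (suc a) l f g))
    (+-interchange (f a) (g a) (∑ (suc a) l f) (∑ (suc a) l g))

  ∑-neg : ∀ a l f → ∑ a l (λ k → - f k) ≈ - ∑ a l f
  ∑-neg a zero f = sym -0#≈0#
  ∑-neg a (suc l) f = trans (+-congˡ (∑-neg (suc a) l f)) (⁻¹-∙-comm (f a) (∑ (suc a) l f))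

  ∑-- : ∀ a l f g → ∑ a l (λ k → f k - g k) ≈ ∑ a l f - ∑ a l g
  ∑-- a l f g = trans (∑-+ a l f (λ k → - g k)) (+-congˡ (∑-neg a l g))

  ∑-*ˡ : ∀ a l x f → ∑ a l (λ k → x * f k) ≈ x * ∑ a l f
  ∑-*ˡ a zero x f = sym (zeroʳ x)
  ∑-*ˡ a (suc l) x f = trans (+-congˡ (∑-*ˡ (suc a) l x f)) (sym (distribˡ x (f a) (∑ (suc a) l f)))

  ∑-zero : ∀ a l f → (∀ k → a ≤ k → f k ≈ 0#) → ∑ a l f ≈ 0#
  ∑-zero a zero f f≈0 = refl
  ∑-zero a (suc l) f f≈0 =
    trans (+-cong (f≈0 a ℕP.≤-refl) (∑-zero (suc a) l f (λ k a<k → f≈0 k (ℕP.<⇒≤ a<k)))) (+-identityˡ 0#)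

  ∑-truncate : ∀ a l L f → l ≤ L → (∀ k → a ℕ.+ l ≤ k → f k ≈ 0#) → ∑ a L f ≈ ∑ a l f
  ∑-truncate a zero L f _ f≈0 = ∑-zero a L f (λ k a≤k → f≈0 k (P.subst (_≤ k) (P.sym (ℕP.+-identityʳ a)) a≤k))
  ∑-truncate a (suc l) (suc L) f (s≤s l≤L) f≈0 =
    +-congˡ (∑-truncate (suc a) l L f l≤L (λ k le → f≈0 k (P.subst (_≤ k) (P.sym (ℕP.+-suc a l)) le)))

  ∑-shift : ∀ a b l f → ∑ (a ℕ.+ b) l f ≈ ∑ b l (λ t → f (a ℕ.+ t))
  ∑-shift a b zero f = refl
  ∑-shift a b (suc l) f = +-congˡ (trans (reflexive (P.cong (λ z → ∑ z l f) (P.sym (ℕP.+-suc a b)))) (∑-shift a (suc b) l f))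

  ∑-from-zero : ∀ a l f → ∑ a l f ≈ ∑ 0 l (λ t → f (a ℕ.+ t))
  ∑-from-zero a l f = trans (reflexive (P.cong (λ z → ∑ z l f) (P.sym (ℕP.+-identityʳ a)))) (∑-shift a 0 l f)

  shiftBy : Carrier → (ℕ → Carrier) → ℕ → Carrier
  shiftBy x f zero = 0#
  shiftBy x f (suc s) = x * f s

  ∑-shiftBy : ∀ l x f → ∑ 0 (suc l) (shiftBy x f) ≈ x * ∑ 0 l f
  ∑-shiftBy l x f = trans (+-identityˡ _) (trans (∑-shift 1 0 l (shiftBy x f)) (∑-*ˡ 0 l x f))

  ∑-shiftBy-difference : ∀ l x f g → ∑ 0 (suc l) (λ k → f k - shiftBy x g k) ≈ ∑ 0 (suc l) f - x * ∑ 0 l g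
  ∑-shiftBy-difference l x f g = trans (∑-- 0 (suc l) f (shiftBy x g)) (+-congˡ (-‿cong (∑-shiftBy l x g)))

  sumFromTo-+ : ∀ a l f → sumFromTo R a (+ (a ℕ.+ l)) f ≈ ∑ a (suc l) f
  sumFromTo-+ a l f with a ℕ.≤ᵇ (a ℕ.+ l) | ℕP.≤⇒≤ᵇ (ℕP.m≤m+n a l)
  ... | true | _ = reflexive (P.cong (λ l → ∑ a (suc l) f) (ℕP.m+n∸m≡n a l))

  sumFromTo-< : ∀ a b f → b < a → sumFromTo R a (+ b) f ≈ 0#
  sumFromTo-< a b f b<a with a ℕ.≤ᵇ b in a≤ᵇb
  ... | false = refl
  ... | true = ⊥-elim (ℕP.<⇒≱ b<a (ℕP.≤ᵇ⇒≤ a b (P.subst T (P.sym a≤ᵇb) _)))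

module Identity {c ℓ : Level} (R : CommutativeRing c ℓ) (y : CommutativeRing.Carrier R) where
  open CommutativeRing R hiding (zero)
  open Sums R
  open import Algebra.Definitions.RawSemiring (Semiring.rawSemiring semiring) using (_^_)
  open import Algebra.Properties.Semiring.Mult semiring using (×-homo-+; ×-homo-1)
  open import Algebra.Properties.Ring ring using (x[y-z]≈xy-xz)
  open import Algebra.Properties.CommutativeSemigroup +-commutativeSemigroup using () renaming (x∙yz≈y∙xz to x+[y+z]≈y+[x+z])
  open import Algebra.Properties.CommutativeSemigroup *-commutativeSemigroup using () renaming (x∙yz≈y∙xz to x*[y*z]≈y*[x*z])
  open import Algebra.Solver.Ring.NaturalCoefficients.Default commutativeSemiring using (solve; _:=_; _:+_; _:*_)
  open import Relation.Binary.Reasoning.Setoid setoid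

  ⟦_⟧ : ℕ → Carrier
  ⟦_⟧ = ι R

  Y : Carrier
  Y = 1# + y

  Y*x≈x+y*x : ∀ x → Y * x ≈ x + y * x
  Y*x≈x+y*x x = trans (distribʳ x 1# y) (+-congʳ (*-identityˡ x))

  ⟦⟧-pascal : ∀ N k → ⟦ suc N C k ⟧ ≈ ⟦ N C k ⟧ + ⟦ N C⁻ k ⟧
  ⟦⟧-pascal N k = trans (reflexive (P.cong ⟦_⟧ ([1+N]Ck≡NCk+NC⁻k N k))) (×-homo-+ 1# (N C k) (N C⁻ k))

  ⟦C⟧-vanish : ∀ {N k} → N < k → ⟦ N C k ⟧ ≈ 0#
  ⟦C⟧-vanish N<k = reflexive (P.cong ⟦_⟧ (k>n⇒nCk≡0 N<k))

  -- The coefficients satisfy c_{-m} = y^m c_m, so c_{-1} is replaced by y c_1.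
  lower : (ℕ → Carrier) → ℕ → Carrier
  lower c zero = y * c 1
  lower c (suc m) = c m

  step : (ℕ → Carrier) → ℕ → Carrier
  step c m = lower c m + Y * c m + y * c (suc m)

  δ : ℕ → Carrier
  δ zero = 1#
  δ (suc m) = 0#

  coeff : ℕ → ℕ → Carrier
  coeff zero = δ
  coeff (suc N) = step (coeff N)

  step-cong : ∀ {c d} → (∀ m → c m ≈ d m) → ∀ m → step c m ≈ step d m
  step-cong c≈d m = +-cong (+-cong (lower-cong m) (*-congˡ (c≈d m))) (*-congˡ (c≈d (suc m)))
    where
    lower-cong : ∀ m → lower _ m ≈ lower _ m
    lower-cong zero = *-congˡ (c≈d 1)
    lower-cong (suc m) = c≈d m

  ≈coeff : (X : ℕ → ℕ → Carrier) → (∀ m → X 0 m ≈ δ m) → (∀ N m → X (suc N) m ≈ step (X N) m) →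
           ∀ N m → X N m ≈ coeff N m
  ≈coeff X X₀ Xₛ zero m = X₀ m
  ≈coeff X X₀ Xₛ (suc N) m = trans (Xₛ N m) (step-cong (≈coeff X X₀ Xₛ N) m)

  lowerTerm : (ℕ → ℕ → Carrier) → ℕ → ℕ → Carrier
  lowerTerm A zero = shiftBy y (A 1)
  lowerTerm A (suc m) = A m

  ∑-lowerTerm : ∀ L A → (∀ m → ∑ 0 (suc L) (A m) ≈ ∑ 0 L (A m)) →
                ∀ m → ∑ 0 (suc L) (lowerTerm A m) ≈ lower (λ m → ∑ 0 L (A m)) m
  ∑-lowerTerm L A _ zero = ∑-shiftBy L y (A 1)
  ∑-lowerTerm L A truncate (suc m) = truncate m

  conv-term : ℕ → ℕ → ℕ → Carrier
  conv-term N m j = y ^ j * (⟦ N C j ⟧ * ⟦ N C (m ℕ.+ j) ⟧)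

  conv : ℕ → ℕ → Carrier
  conv N m = ∑ 0 (suc N) (conv-term N m)

  conv-term-vanish : ∀ N m j → N < m ℕ.+ j → conv-term N m j ≈ 0#
  conv-term-vanish N m j N<m+j = trans (*-congˡ (trans (*-congˡ (⟦C⟧-vanish N<m+j)) (zeroʳ _))) (zeroʳ _)

  conv-∑-truncate : ∀ N m {l L} → l ≤ L → N < m ℕ.+ l → ∑ 0 L (conv-term N m) ≈ ∑ 0 l (conv-term N m)
  conv-∑-truncate N m {l} {L} l≤L N<m+l = ∑-truncate 0 l L (conv-term N m) l≤L
    (λ j l≤j → conv-term-vanish N m j (ℕP.<-≤-trans N<m+l (ℕP.+-monoʳ-≤ m l≤j)))

  conv-truncate : ∀ N m → ∑ 0 (suc (suc N)) (conv-term N m) ≈ conv N m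
  conv-truncate N m = conv-∑-truncate N m {suc N} (ℕP.n≤1+n _) (ℕP.m≤n+m (suc N) m)

  conv-term-lower : ∀ N m j → y ^ j * (⟦ N C j ⟧ * ⟦ N C⁻ (m ℕ.+ j) ⟧) ≈ lowerTerm (conv-term N) m j
  conv-term-lower N zero zero = trans (*-congˡ (zeroʳ _)) (zeroʳ _)
  conv-term-lower N zero (suc s) =
    solve 4 (λ y p a b → (y :* p) :* (a :* b) := y :* (p :* (b :* a))) refl y (y ^ s) ⟦ N C suc s ⟧ ⟦ N C s ⟧
  conv-term-lower N (suc m) j = refl

  conv-term-raise : ∀ N m j → y ^ j * (⟦ N C⁻ j ⟧ * ⟦ N C (m ℕ.+ j) ⟧) ≈ shiftBy y (conv-term N (suc m)) j
  conv-term-raise N m zero = trans (*-congˡ (zeroˡ _)) (zeroʳ _)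
  conv-term-raise N m (suc s) =
    trans (*-assoc y (y ^ s) _) (*-congˡ (*-congˡ (*-congˡ (reflexive (P.cong (λ k → ⟦ N C k ⟧) (ℕP.+-suc m s))))))

  conv-term-shift : ∀ N m j → y ^ j * (⟦ N C⁻ j ⟧ * ⟦ N C⁻ (m ℕ.+ j) ⟧) ≈ shiftBy y (conv-term N m) j
  conv-term-shift N m zero = trans (*-congˡ (zeroˡ _)) (zeroʳ _)
  conv-term-shift N m (suc s) =
    trans (*-assoc y (y ^ s) _) (*-congˡ (*-congˡ (*-congˡ (reflexive (P.cong (λ k → ⟦ N C⁻ k ⟧) (ℕP.+-suc m s))))))

  conv-term-step : ∀ N m j → conv-term (suc N) m j ≈
    conv-term N m j + (lowerTerm (conv-term N) m j + (shiftBy y (conv-term N (suc m)) j + shiftBy y (conv-term N m) j))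
  conv-term-step N m j = begin
    p * (⟦ suc N C j ⟧ * ⟦ suc N C (m ℕ.+ j) ⟧)  ≈⟨ *-congˡ (*-cong (⟦⟧-pascal N j) (⟦⟧-pascal N (m ℕ.+ j))) ⟩
    p * ((a + a⁻) * (b + b⁻))                    ≈⟨ expand ⟩
    p * (a * b) + (p * (a * b⁻) + (p * (a⁻ * b) + p * (a⁻ * b⁻)))
      ≈⟨ +-congˡ (+-cong (conv-term-lower N m j) (+-cong (conv-term-raise N m j) (conv-term-shift N m j))) ⟩
    conv-term N m j + (lowerTerm (conv-term N) m j + (shiftBy y (conv-term N (suc m)) j + shiftBy y (conv-term N m) j)) ∎
    where
    p a a⁻ b b⁻ : Carrier
    p = y ^ j
    a = ⟦ N C j ⟧
    a⁻ = ⟦ N C⁻ j ⟧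
    b = ⟦ N C (m ℕ.+ j) ⟧
    b⁻ = ⟦ N C⁻ (m ℕ.+ j) ⟧
    expand : p * ((a + a⁻) * (b + b⁻)) ≈ p * (a * b) + (p * (a * b⁻) + (p * (a⁻ * b) + p * (a⁻ * b⁻)))
    expand = solve 5 (λ p a a⁻ b b⁻ → p :* ((a :+ a⁻) :* (b :+ b⁻)) :=
                        p :* (a :* b) :+ (p :* (a :* b⁻) :+ (p :* (a⁻ :* b) :+ p :* (a⁻ :* b⁻)))) refl p a a⁻ b b⁻

  conv-step : ∀ N m → conv (suc N) m ≈ step (conv N) m
  conv-step N m = begin
    ∑ 0 L (conv-term (suc N) m)
      ≈⟨ ∑-cong 0 L (conv-term-step N m) ⟩
    ∑ 0 L (λ j → conv-term N m j + (lowerTerm (conv-term N) m j + (shiftBy y (conv-term N (suc m)) j + shiftBy y (conv-term N m) j)))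
      ≈⟨ trans (∑-+ 0 L _ _) (+-congˡ (trans (∑-+ 0 L _ _) (+-congˡ (∑-+ 0 L _ _)))) ⟩
    ∑ 0 L (conv-term N m) + (∑ 0 L (lowerTerm (conv-term N) m)
                              + (∑ 0 L (shiftBy y (conv-term N (suc m))) + ∑ 0 L (shiftBy y (conv-term N m))))
      ≈⟨ +-cong (conv-truncate N m) (+-cong (∑-lowerTerm (suc N) (conv-term N) (conv-truncate N) m)
                                            (+-cong (∑-shiftBy (suc N) y _) (∑-shiftBy (suc N) y _))) ⟩
    conv N m + (lower (conv N) m + (y * conv N (suc m) + y * conv N m))
      ≈⟨ solve 4 (λ c l c⁺ y → c :+ (l :+ (y :* c⁺ :+ y :* c)) := l :+ (c :+ y :* c) :+ y :* c⁺) refl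
           (conv N m) (lower (conv N) m) (conv N (suc m)) y ⟩
    lower (conv N) m + (conv N m + y * conv N m) + y * conv N (suc m)
      ≈⟨ +-congʳ (+-congˡ (sym (Y*x≈x+y*x (conv N m)))) ⟩
    step (conv N) m ∎
    where
    L : ℕ
    L = suc (suc N)

  ⟦1⟧≈1 : ⟦ 1 ⟧ ≈ 1#
  ⟦1⟧≈1 = ×-homo-1 1#

  conv-zero : ∀ m → conv 0 m ≈ δ m
  conv-zero zero = trans (+-identityʳ _) (trans (*-identityˡ _) (trans (*-cong ⟦1⟧≈1 ⟦1⟧≈1) (*-identityˡ 1#)))
  conv-zero (suc m) = trans (+-identityʳ _) (trans (*-identityˡ _) (zeroʳ _))

  τ : ℕ → ℕ → ℕ → Carrier
  τ N k t = y ^ t * (⟦ N C k ⟧ * (⟦ k C t ⟧ * Y ^ (N ℕ.∸ k)))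

  ⟦C⟧*Y^[1+N∸k] : ∀ N k → ⟦ N C k ⟧ * Y ^ (suc N ℕ.∸ k) ≈ Y * (⟦ N C k ⟧ * Y ^ (N ℕ.∸ k))
  ⟦C⟧*Y^[1+N∸k] N k with k ℕ.≤? N
  ... | yes k≤N = trans (*-congˡ (reflexive (P.cong (Y ^_) (ℕP.+-∸-assoc 1 k≤N)))) (x*[y*z]≈y*[x*z] _ Y _)
  ... | no k≰N = trans (*-congʳ C≈0) (trans (zeroˡ _) (sym (trans (*-congˡ (trans (*-congʳ C≈0) (zeroˡ _))) (zeroʳ Y))))
    where
    C≈0 : ⟦ N C k ⟧ ≈ 0#
    C≈0 = ⟦C⟧-vanish (ℕP.≰⇒> k≰N)

  τ-step : ∀ N k t → τ (suc N) k t ≈ Y * τ N k t + y ^ t * (⟦ N C⁻ k ⟧ * (⟦ k C t ⟧ * Y ^ (suc N ℕ.∸ k)))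
  τ-step N k t = begin
    y ^ t * (⟦ suc N C k ⟧ * (b * E′))             ≈⟨ *-congˡ (*-congʳ (⟦⟧-pascal N k)) ⟩
    y ^ t * ((a + a⁻) * (b * E′))                  ≈⟨ trans (*-congˡ (distribʳ _ a a⁻)) (distribˡ _ _ _) ⟩
    y ^ t * (a * (b * E′)) + y ^ t * (a⁻ * (b * E′)) ≈⟨ +-congʳ (*-congˡ lead) ⟩
    y ^ t * (Y * (a * (b * E))) + y ^ t * (a⁻ * (b * E′))
      ≈⟨ +-congʳ (x*[y*z]≈y*[x*z] (y ^ t) Y (a * (b * E))) ⟩
    Y * τ N k t + y ^ t * (a⁻ * (b * E′)) ∎
    where
    a a⁻ b E E′ : Carrier
    a = ⟦ N C k ⟧
    a⁻ = ⟦ N C⁻ k ⟧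
    b = ⟦ k C t ⟧
    E = Y ^ (N ℕ.∸ k)
    E′ = Y ^ (suc N ℕ.∸ k)
    lead : a * (b * E′) ≈ Y * (a * (b * E))
    lead = trans (x*[y*z]≈y*[x*z] a b E′)
      (trans (*-congˡ (⟦C⟧*Y^[1+N∸k] N k)) (solve 4 (λ b Y a E → b :* (Y :* (a :* E)) := Y :* (a :* (b :* E))) refl b Y a E))

  τ-step-zero : ∀ N t → τ (suc N) 0 t ≈ Y * τ N 0 t
  τ-step-zero N t = trans (τ-step N 0 t) (trans (+-congˡ (trans (*-congˡ (zeroˡ _)) (zeroʳ _))) (+-identityʳ _))

  τ-step-suc : ∀ N k t → τ (suc N) (suc k) t ≈ Y * τ N (suc k) t + (τ N k t + shiftBy y (τ N k) t)
  τ-step-suc N k t = trans (τ-step N (suc k) t) (+-congˡ (begin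
    y ^ t * (a * (⟦ suc k C t ⟧ * E))             ≈⟨ *-congˡ (*-congˡ (*-congʳ (⟦⟧-pascal k t))) ⟩
    y ^ t * (a * ((⟦ k C t ⟧ + ⟦ k C⁻ t ⟧) * E))   ≈⟨ split ⟩
    τ N k t + y ^ t * (a * (⟦ k C⁻ t ⟧ * E))       ≈⟨ +-congˡ (lowered t) ⟩
    τ N k t + shiftBy y (τ N k) t ∎))
    where
    a E : Carrier
    a = ⟦ N C k ⟧
    E = Y ^ (N ℕ.∸ k)
    split : y ^ t * (a * ((⟦ k C t ⟧ + ⟦ k C⁻ t ⟧) * E)) ≈ τ N k t + y ^ t * (a * (⟦ k C⁻ t ⟧ * E))
    split = solve 5 (λ p a b b⁻ E → p :* (a :* ((b :+ b⁻) :* E)) := p :* (a :* (b :* E)) :+ p :* (a :* (b⁻ :* E)))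
              refl (y ^ t) a ⟦ k C t ⟧ ⟦ k C⁻ t ⟧ E
    lowered : ∀ t → y ^ t * (a * (⟦ k C⁻ t ⟧ * E)) ≈ shiftBy y (τ N k) t
    lowered zero = trans (*-congˡ (trans (*-congˡ (zeroˡ E)) (zeroʳ a))) (zeroʳ _)
    lowered (suc s) = *-assoc y (y ^ s) _

  τ-central : ∀ N s → τ N (suc (2 ℕ.* s)) (suc s) ≈ y * τ N (suc (2 ℕ.* s)) s
  τ-central N s = trans (*-assoc y (y ^ s) _)
    (*-congˡ (*-congˡ (*-congˡ (*-congʳ (reflexive (P.cong ⟦_⟧ (P.sym ([1+2s]Cs≡[1+2s]C[1+s] s))))))))

  trin-term : ℕ → ℕ → ℕ → Carrier
  trin-term N m t = τ N (m ℕ.+ 2 ℕ.* t) t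

  trin : ℕ → ℕ → Carrier
  trin N m = ∑ 0 (suc N) (trin-term N m)

  trin-term-vanish : ∀ N m t → N < m ℕ.+ 2 ℕ.* t → trin-term N m t ≈ 0#
  trin-term-vanish N m t N<k = trans (*-congˡ (trans (*-congʳ (⟦C⟧-vanish N<k)) (zeroˡ _))) (zeroʳ _)

  trin-∑-truncate : ∀ N m {l L} → l ≤ L → N < m ℕ.+ 2 ℕ.* l → ∑ 0 L (trin-term N m) ≈ ∑ 0 l (trin-term N m)
  trin-∑-truncate N m {l} {L} l≤L N<m+2l = ∑-truncate 0 l L (trin-term N m) l≤L
    (λ t l≤t → trin-term-vanish N m t (ℕP.<-≤-trans N<m+2l (ℕP.+-monoʳ-≤ m (ℕP.*-monoʳ-≤ 2 l≤t))))

  trin-truncate : ∀ N m → ∑ 0 (suc (suc N)) (trin-term N m) ≈ trin N m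
  trin-truncate N m = trin-∑-truncate N m {suc N} (ℕP.n≤1+n _)
    (ℕP.<-≤-trans (ℕP.n<1+n N) (ℕP.≤-trans (ℕP.m≤m+n (suc N) (suc N ℕ.+ 0)) (ℕP.m≤n+m _ m)))

  trin-term-suc : ∀ N m s → trin-term N m (suc s) ≈ τ N (suc (suc (m ℕ.+ 2 ℕ.* s))) (suc s)
  trin-term-suc N m s = reflexive (P.cong (λ k → τ N k (suc s)) (m+2[1+s]≡2+[m+2s] m s))

  shiftBy-τ : ∀ N m t → shiftBy y (τ N (m ℕ.+ 2 ℕ.* t)) t ≈ shiftBy y (trin-term N (suc (suc m))) t
  shiftBy-τ N m zero = refl
  shiftBy-τ N m (suc s) = *-congˡ (reflexive (P.cong (λ k → τ N k s) (m+2[1+s]≡2+[m+2s] m s)))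

  trin-term-step : ∀ N m t → trin-term (suc N) m t ≈
    lowerTerm (trin-term N) m t + (Y * trin-term N m t + shiftBy y (trin-term N (suc m)) t)
  trin-term-step N zero zero = trans (τ-step-zero N 0) (sym (trans (+-identityˡ _) (+-identityʳ _)))
  trin-term-step N zero (suc s) = begin
    trin-term (suc N) 0 (suc s)                               ≈⟨ trin-term-suc (suc N) 0 s ⟩
    τ (suc N) (suc k) (suc s)                                 ≈⟨ τ-step-suc N k (suc s) ⟩
    Y * τ N (suc k) (suc s) + (τ N k (suc s) + y * τ N k s)
      ≈⟨ +-cong (*-congˡ (sym (trin-term-suc N 0 s))) (+-congʳ (τ-central N s)) ⟩
    Y * trin-term N 0 (suc s) + (y * τ N k s + y * τ N k s)   ≈⟨ x+[y+z]≈y+[x+z] _ _ _ ⟩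
    y * τ N k s + (Y * trin-term N 0 (suc s) + y * τ N k s)   ∎
    where
    k : ℕ
    k = suc (2 ℕ.* s)
  trin-term-step N (suc m) t = begin
    τ (suc N) (suc k) t                                       ≈⟨ τ-step-suc N k t ⟩
    Y * τ N (suc k) t + (τ N k t + shiftBy y (τ N k) t)       ≈⟨ +-congˡ (+-congˡ (shiftBy-τ N m t)) ⟩
    Y * τ N (suc k) t + (τ N k t + shiftBy y (trin-term N (suc (suc m))) t)
      ≈⟨ x+[y+z]≈y+[x+z] _ _ _ ⟩
    τ N k t + (Y * τ N (suc k) t + shiftBy y (trin-term N (suc (suc m))) t) ∎
    where
    k : ℕ
    k = m ℕ.+ 2 ℕ.* t

  trin-step : ∀ N m → trin (suc N) m ≈ step (trin N) m
  trin-step N m = begin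
    ∑ 0 L (trin-term (suc N) m)
      ≈⟨ ∑-cong 0 L (trin-term-step N m) ⟩
    ∑ 0 L (λ t → lowerTerm (trin-term N) m t + (Y * trin-term N m t + shiftBy y (trin-term N (suc m)) t))
      ≈⟨ trans (∑-+ 0 L _ _) (+-congˡ (trans (∑-+ 0 L _ _) (+-congʳ (∑-*ˡ 0 L Y (trin-term N m))))) ⟩
    ∑ 0 L (lowerTerm (trin-term N) m) + (Y * ∑ 0 L (trin-term N m) + ∑ 0 L (shiftBy y (trin-term N (suc m))))
      ≈⟨ +-cong (∑-lowerTerm (suc N) (trin-term N) (trin-truncate N) m)
                (+-cong (*-congˡ (trin-truncate N m)) (∑-shiftBy (suc N) y _)) ⟩
    lower (trin N) m + (Y * trin N m + y * trin N (suc m))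
      ≈⟨ sym (+-assoc _ _ _) ⟩
    step (trin N) m ∎
    where
    L : ℕ
    L = suc (suc N)

  trin-zero : ∀ m → trin 0 m ≈ δ m
  trin-zero zero = trans (+-identityʳ _) (trans (*-identityˡ _)
    (trans (*-cong ⟦1⟧≈1 (trans (*-cong ⟦1⟧≈1 refl) (*-identityˡ 1#))) (*-identityˡ 1#)))
  trin-zero (suc m) = trans (+-identityʳ _) (trans (*-identityˡ _) (zeroˡ _))

  conv≈trin : ∀ N m → conv N m ≈ trin N m
  conv≈trin N m = trans (≈coeff conv conv-zero conv-step N m) (sym (≈coeff trin trin-zero trin-step N m))

  τ-ballot : ∀ N k t → y ^ t * ⟦ N C k ⟧ * Y ^ (N ℕ.∸ k) * (⟦ k C t ⟧ - ⟦ k C⁻ t ⟧)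
                       ≈ τ N k t - shiftBy y (τ N k) t
  τ-ballot N k t = trans (x[y-z]≈xy-xz _ _ _) (+-cong (reorder t ⟦ k C t ⟧) (-‿cong (lowered t)))
    where
    reorder : ∀ t b → y ^ t * ⟦ N C k ⟧ * Y ^ (N ℕ.∸ k) * b ≈ y ^ t * (⟦ N C k ⟧ * (b * Y ^ (N ℕ.∸ k)))
    reorder t b = solve 4 (λ p a E b → p :* a :* E :* b := p :* (a :* (b :* E))) refl (y ^ t) ⟦ N C k ⟧ (Y ^ (N ℕ.∸ k)) b
    lowered : ∀ t → y ^ t * ⟦ N C k ⟧ * Y ^ (N ℕ.∸ k) * ⟦ k C⁻ t ⟧ ≈ shiftBy y (τ N k) t
    lowered zero = zeroʳ _
    lowered (suc s) = trans (reorder (suc s) ⟦ k C s ⟧) (*-assoc y (y ^ s) _)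

  conv-ballot : ∀ N m j → y ^ j * (⟦ N C j ⟧ * ⟦ N C (m ℕ.+ j) ⟧ - ⟦ N C⁻ j ⟧ * ⟦ N C (m ℕ.+ j ℕ.+ 1) ⟧)
                          ≈ conv-term N m j - shiftBy y (conv-term N (suc (suc m))) j
  conv-ballot N m j = trans (x[y-z]≈xy-xz _ _ _) (+-congˡ (-‿cong (raised j)))
    where
    raised : ∀ j → y ^ j * (⟦ N C⁻ j ⟧ * ⟦ N C (m ℕ.+ j ℕ.+ 1) ⟧) ≈ shiftBy y (conv-term N (suc (suc m))) j
    raised zero = trans (*-congˡ (zeroˡ _)) (zeroʳ _)
    raised (suc s) = trans (*-assoc y (y ^ s) _)
      (*-congˡ (*-congˡ (*-congˡ (reflexive (P.cong (λ k → ⟦ N C k ⟧) (m+[1+s]+1≡2+m+s m s))))))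
      where
      m+[1+s]+1≡2+m+s : ∀ m s → m ℕ.+ suc s ℕ.+ 1 ≡ suc (suc (m ℕ.+ s))
      m+[1+s]+1≡2+m+s m s = P.trans (ℕP.+-comm (m ℕ.+ suc s) 1) (P.cong suc (ℕP.+-suc m s))

  lhs-term : ℕ → ℕ → ℕ → ℕ → Carrier
  lhs-term N n i k = y ^ (k ℕ.∸ i) * ⟦ binomℤ N (+ (n ℕ.+ 2 ℕ.* k)) ⟧ * Y ^ (N ℕ.∸ n ℕ.∸ 2 ℕ.* k)
    * (⟦ binomℤ (n ℕ.+ 2 ℕ.* k) (+ k ℤ.- + i) ⟧ - ⟦ binomℤ (n ℕ.+ 2 ℕ.* k) (+ k ℤ.- + i ℤ.- ℤ.1ℤ) ⟧)

  rhs-term : ℕ → ℕ → ℕ → ℕ → Carrier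
  rhs-term N n i j = y ^ j * (⟦ binomℤ N (+ j) ⟧ * ⟦ binomℤ N (+ (n ℕ.+ 2 ℕ.* i ℕ.+ j)) ⟧
                              - ⟦ binomℤ N (+ j ℤ.- ℤ.1ℤ) ⟧ * ⟦ binomℤ N (+ (n ℕ.+ 2 ℕ.* i ℕ.+ j ℕ.+ 1)) ⟧)

  lhs : ℕ → ℕ → ℕ → Carrier
  lhs N n i = sumFromTo R i ⌊ + N ℤ.- + n /2⌋ (lhs-term N n i)

  rhs : ℕ → ℕ → ℕ → Carrier
  rhs N n i = sumFromTo R 0 (+ N ℤ.- + n ℤ.- + (2 ℕ.* i)) (rhs-term N n i)

  lhs-term-from-i : ∀ N n i t → lhs-term N n i (i ℕ.+ t) ≈
    trin-term N (n ℕ.+ 2 ℕ.* i) t - shiftBy y (trin-term N (suc (suc (n ℕ.+ 2 ℕ.* i)))) t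
  lhs-term-from-i N n i t
    rewrite ℕP.m+n∸m≡n i t | ℕP.∸-+-assoc N n (2 ℕ.* (i ℕ.+ t)) | n+2[i+t]≡[n+2i]+2t n i t
          | +[m+n]-+m≡+n i t | binomℤ[t-1]≡C⁻ (n ℕ.+ 2 ℕ.* i ℕ.+ 2 ℕ.* t) t
    = trans (τ-ballot N _ t) (+-congˡ (-‿cong (shiftBy-τ N (n ℕ.+ 2 ℕ.* i) t)))

  rhs-term≈conv-ballot : ∀ N n i j → rhs-term N n i j ≈
    conv-term N (n ℕ.+ 2 ℕ.* i) j - shiftBy y (conv-term N (suc (suc (n ℕ.+ 2 ℕ.* i)))) j
  rhs-term≈conv-ballot N n i j rewrite binomℤ[t-1]≡C⁻ N j = conv-ballot N (n ℕ.+ 2 ℕ.* i) j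

  lhs≈trin-difference : ∀ n i d → let m = n ℕ.+ 2 ℕ.* i; N = m ℕ.+ d in
    lhs N n i ≈ trin N m - y * trin N (suc (suc m))
  lhs≈trin-difference n i d = begin
    lhs N n i                                     ≈⟨ reflexive (P.cong (λ b → sumFromTo R i b (lhs-term N n i)) bound) ⟩
    sumFromTo R i (+ (i ℕ.+ h)) (lhs-term N n i)  ≈⟨ sumFromTo-+ i h _ ⟩
    ∑ i (suc h) (lhs-term N n i)                  ≈⟨ ∑-from-zero i (suc h) _ ⟩
    ∑ 0 (suc h) (λ t → lhs-term N n i (i ℕ.+ t))  ≈⟨ ∑-cong 0 (suc h) (lhs-term-from-i N n i) ⟩
    ∑ 0 (suc h) (λ t → trin-term N m t - shiftBy y (trin-term N (suc (suc m))) t)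
      ≈⟨ ∑-shiftBy-difference h y _ _ ⟩
    ∑ 0 (suc h) (trin-term N m) - y * ∑ 0 h (trin-term N (suc (suc m)))
      ≈⟨ +-cong (trin-∑-truncate N m (s≤s h≤N) N<m+2[1+h])
                (-‿cong (*-congˡ (trin-∑-truncate N (suc (suc m)) (ℕP.m≤n⇒m≤1+n h≤N) N<2+m+2h))) ⟨
    trin N m - y * trin N (suc (suc m)) ∎
    where
    m N h : ℕ
    m = n ℕ.+ 2 ℕ.* i
    N = m ℕ.+ d
    h = d ℕ./ 2
    bound : ⌊ + N ℤ.- + n /2⌋ ≡ + (i ℕ.+ h)
    bound = P.trans (P.cong ⌊_/2⌋ (P.trans (P.cong (λ x → + x ℤ.- + n) (ℕP.+-assoc n (2 ℕ.* i) d))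
                                          (+[m+n]-+m≡+n n (2 ℕ.* i ℕ.+ d))))
                    (P.cong +_ ([2i+d]/2≡i+d/2 i d))
    h≤N : h ≤ N
    h≤N = ℕP.≤-trans (m/n≤m d 2) (ℕP.m≤n+m d m)
    N<m+2[1+h] : N < m ℕ.+ 2 ℕ.* suc h
    N<m+2[1+h] = ℕP.+-monoʳ-< m (d/2<t⇒d<2t (ℕP.n<1+n h))
    N<2+m+2h : N < suc (suc m) ℕ.+ 2 ℕ.* h
    N<2+m+2h = P.subst (N <_) (m+2[1+s]≡2+[m+2s] m h) N<m+2[1+h]

  rhs≈conv-difference : ∀ n i d → let m = n ℕ.+ 2 ℕ.* i; N = m ℕ.+ d in
    rhs N n i ≈ conv N m - y * conv N (suc (suc m))
  rhs≈conv-difference n i d = begin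
    rhs N n i                                    ≈⟨ reflexive (P.cong (λ b → sumFromTo R 0 b (rhs-term N n i)) bound) ⟩
    sumFromTo R 0 (+ d) (rhs-term N n i)         ≈⟨ sumFromTo-+ 0 d _ ⟩
    ∑ 0 (suc d) (rhs-term N n i)                 ≈⟨ ∑-cong 0 (suc d) (rhs-term≈conv-ballot N n i) ⟩
    ∑ 0 (suc d) (λ j → conv-term N m j - shiftBy y (conv-term N (suc (suc m))) j)
      ≈⟨ ∑-shiftBy-difference d y _ _ ⟩
    ∑ 0 (suc d) (conv-term N m) - y * ∑ 0 d (conv-term N (suc (suc m)))
      ≈⟨ +-cong (conv-∑-truncate N m (s≤s d≤N) (ℕP.+-monoʳ-< m (ℕP.n<1+n d)))
                (-‿cong (*-congˡ (conv-∑-truncate N (suc (suc m)) (ℕP.m≤n⇒m≤1+n d≤N)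
                                                   (ℕP.m<n⇒m<1+n (ℕP.n<1+n N))))) ⟨
    conv N m - y * conv N (suc (suc m)) ∎
    where
    m N : ℕ
    m = n ℕ.+ 2 ℕ.* i
    N = m ℕ.+ d
    bound : + N ℤ.- + n ℤ.- + (2 ℕ.* i) ≡ + d
    bound = P.trans (+m-+n-+o≡+m-+[n+o] N n (2 ℕ.* i)) (+[m+n]-+m≡+n m d)
    d≤N : d ≤ N
    d≤N = ℕP.m≤n+m d m

  lhs-vanish : ∀ N n i → N < n ℕ.+ 2 ℕ.* i → lhs N n i ≈ 0#
  lhs-vanish N n i N<m with n ℕ.≤? N
  ... | no n≰N = reflexive (P.cong (λ b → sumFromTo R i ⌊ b /2⌋ (lhs-term N n i))
                                   (m<n⇒+m-+n≡-[1+n∸1+m] (ℕP.≰⇒> n≰N)))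
  ... | yes n≤N = trans (reflexive (P.cong (λ b → sumFromTo R i ⌊ b /2⌋ (lhs-term N n i)) (+m-+n≡+[m∸n] n≤N)))
                        (sumFromTo-< i _ _ (m<n*o⇒m/o<n N∸n<i*2))
    where
    N∸n<i*2 : N ℕ.∸ n < i ℕ.* 2
    N∸n<i*2 = P.subst (N ℕ.∸ n <_) (P.trans (ℕP.m+n∸m≡n n (2 ℕ.* i)) (ℕP.*-comm 2 i)) (ℕP.∸-monoˡ-< N<m n≤N)

  rhs-vanish : ∀ N n i → N < n ℕ.+ 2 ℕ.* i → rhs N n i ≈ 0#
  rhs-vanish N n i N<m = reflexive (P.cong (λ b → sumFromTo R 0 b (rhs-term N n i))
    (P.trans (+m-+n-+o≡+m-+[n+o] N n (2 ℕ.* i)) (m<n⇒+m-+n≡-[1+n∸1+m] N<m)))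

lemma5p2 : {c ℓ : Level} (R : CommutativeRing c ℓ) (y : CommutativeRing.Carrier R) (N n i : ℕ) →
  let open CommutativeRing R
      pw = pow R
      cast = ι R
  in sumFromTo R i ⌊ (+ N) ℤ.- (+ n) /2⌋
       (λ k → pw y (k ℕ.∸ i) * cast (binomℤ N (+ (n ℕ.+ 2 ℕ.* k))) * pw (1# + y) (N ℕ.∸ n ℕ.∸ 2 ℕ.* k)
              * (cast (binomℤ (n ℕ.+ 2 ℕ.* k) ((+ k) ℤ.- (+ i)))
                 - cast (binomℤ (n ℕ.+ 2 ℕ.* k) ((+ k) ℤ.- (+ i) ℤ.- ℤ.1ℤ))))
     ≈ sumFromTo R 0 ((+ N) ℤ.- (+ n) ℤ.- (+ (2 ℕ.* i)))
       (λ j → pw y j * (cast (binomℤ N (+ j)) * cast (binomℤ N (+ (n ℕ.+ 2 ℕ.* i ℕ.+ j)))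
                        - cast (binomℤ N ((+ j) ℤ.- ℤ.1ℤ)) * cast (binomℤ N (+ (n ℕ.+ 2 ℕ.* i ℕ.+ j ℕ.+ 1)))))
lemma5p2 R y N n i with n ℕ.+ 2 ℕ.* i ℕ.≤? N
... | no m≰N = trans (lhs-vanish N n i N<m) (sym (rhs-vanish N n i N<m))
  where
  open CommutativeRing R
  open Identity R y
  N<m : N < n ℕ.+ 2 ℕ.* i
  N<m = ℕP.≰⇒> m≰N
... | yes m≤N = P.subst (λ N → lhs N n i ≈ rhs N n i) (ℕP.m+[n∸m]≡n m≤N) (begin
    lhs N′ n i                             ≈⟨ lhs≈trin-difference n i d ⟩
    trin N′ m - y * trin N′ (suc (suc m))
      ≈⟨ +-cong (conv≈trin N′ m) (-‿cong (*-congˡ (conv≈trin N′ (suc (suc m))))) ⟨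
    conv N′ m - y * conv N′ (suc (suc m))  ≈⟨ rhs≈conv-difference n i d ⟨
    rhs N′ n i                             ∎)
  where
  open CommutativeRing R
  open Identity R y
  open import Relation.Binary.Reasoning.Setoid setoid
  m d N′ : ℕ
  m = n ℕ.+ 2 ℕ.* i
  d = N ℕ.∸ m
  N′ = m ℕ.+ d
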